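{- Let $n>2$ be odd and let $\mathbf{A}_n$ be the algebra defined below. For every $(n-1)$-element subset $E$ of $A_n$, there is a term operation $s$ of $\mathbf{A}_n$ such that $s(y,x,x)=s(x,y,x)=s(x,x,y)=y$ for all $x,y\in E$.
   Context: Let $[n]=\{1,\dots,n\}$ and let $m$ be the minority operation on $[n]$ given by $m(x,y,z)=x$ if $y=z$, $m(x,y,z)=y$ if $x=z$, and $m(x,y,z)=z$ otherwise. On $\{0,1,2,3\}$, let $+$ and $-$ denote addition and subtraction modulo $4$, and $\oplus$ denote bitwise XOR of binary representations. Let $A_n=[n]\times\{0,1,2,3\}$. For $i\in[n]$ define the ternary operation $t_i$ on $A_n$ by $t_i((a_1,b_1),(a_2,b_2),(a_3,b_3))=(i,\,b_1-b_2+b_3)$ if $a_1=a_2=a_3=i$, and $=(m(a_1,a_2,a_3),\,b_1\oplus b_2\oplus b_3)$ otherwise. The algebra $\mathbf{A}_n$ has universe $A_n$ and basic operations $t_1,\dots,t_n$. -}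

module Defs where

open import Data.Nat using (ℕ; zero; suc; _+_; _∸_; _<_; _%_)
open import Data.Nat.DivMod using (m%n<n)
open import Data.Fin using (Fin; toℕ; fromℕ<; _≟_)
open import Data.Fin.Patterns using (0F; 1F; 2F; 3F)
open import Data.Bool using (Bool; true; false; _xor_)
open import Data.Product using (_×_; _,_; proj₁; proj₂)
open import Relation.Nullary using (yes; no)
open import Relation.Binary.PropositionalEquality using (_≡_)
open import Function.Definitions using (Injective)

-- [n] is represented by Fin n (index i ∈ Fin n stands for i+1 ∈ [n]).
-- {0,1,2,3} is represented by Fin 4.

minority : ∀ {n} → Fin n → Fin n → Fin n → Fin n
minority x y z with y ≟ z
... | yes _ = x
... | no _ with x ≟ z
...   | yes _ = y
...   | no _ = z

mod4 : ℕ → Fin 4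
mod4 k = fromℕ< (m%n<n k 4)

addSubAdd : Fin 4 → Fin 4 → Fin 4 → Fin 4
addSubAdd b₁ b₂ b₃ = mod4 (toℕ b₁ + (4 ∸ toℕ b₂) + toℕ b₃)

bits : Fin 4 → Bool × Bool
bits 0F = false , false
bits 1F = false , true
bits 2F = true , false
bits 3F = true , true

fromBits : Bool × Bool → Fin 4
fromBits (false , false) = 0F
fromBits (false , true) = 1F
fromBits (true , false) = 2F
fromBits (true , true) = 3F

_⊕_ : Fin 4 → Fin 4 → Fin 4
a ⊕ b = fromBits (proj₁ (bits a) xor proj₁ (bits b) , proj₂ (bits a) xor proj₂ (bits b))

A : ℕ → Set
A n = Fin n × Fin 4

t : ∀ {n} → Fin n → A n → A n → A n → A n
t i (a₁ , b₁) (a₂ , b₂) (a₃ , b₃) with a₁ ≟ i | a₂ ≟ i | a₃ ≟ i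
... | yes _ | yes _ | yes _ = i , addSubAdd b₁ b₂ b₃
... | _ | _ | _ = minority a₁ a₂ a₃ , ((b₁ ⊕ b₂) ⊕ b₃)

data Term (n k : ℕ) : Set where
  var : Fin k → Term n k
  op  : Fin n → Term n k → Term n k → Term n k → Term n k

⟦_⟧ : ∀ {n k} → Term n k → (Fin k → A n) → A n
⟦ var j ⟧ ρ = ρ j
⟦ op i u v w ⟧ ρ = t i (⟦ u ⟧ ρ) (⟦ v ⟧ ρ) (⟦ w ⟧ ρ)

app3 : ∀ {n} → Term n 3 → A n → A n → A n → A n
app3 s x y z = ⟦ s ⟧ env
  where
  env : Fin 3 → A _
  env 0F = x
  env 1F = y
  env 2F = z

module Submission where

-- Call a ternary operation f a minority operation on a subset
-- if f(y,x,x) = f(x,y,x) = f(x,x,y) = y for all x, y in that subset.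
--   * The minority map on [n] and the threefold XOR b₁ ⊕ b₂ ⊕ b₃ on
--     {0,1,2,3} are minority operations on their whole carriers.
--   * If no element of a subset E ⊆ A_n has first coordinate k, then on E
--     the basic operation t_k is computed coordinatewise by minority and
--     XOR, hence is a minority operation on E.
--   * An (n-1)-element subset of A_n = [n] × {0,1,2,3} misses some first
--     coordinate k ∈ [n], by the pigeonhole principle.
-- So the one-symbol term t_k(x₁,x₂,x₃) works.

open import Defs
open import Data.Nat using (ℕ; suc; _<_; _∸_; _%_)
open import Data.Nat.Properties using (1+n≰n)
open import Data.Fin using (Fin; _≟_)
open import Data.Fin.Patterns using (0F; 1F; 2F; 3F)
open import Data.Fin.Properties using (any?; all?; ¬∀⟶∃¬; injective⇒≤)
open import Data.Product using (Σ; ∃; _×_; _,_; proj₁; proj₂)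
open import Relation.Nullary using (yes; no; contradiction)
open import Relation.Binary.PropositionalEquality
  using (_≡_; _≢_; refl; sym; trans; cong; cong₂)
open import Function.Definitions using (Injective)

IsMinorityOn : ∀ {I X : Set} → (X → X → X → X) → (I → X) → Set
IsMinorityOn f e = ∀ i j →
  (f (e j) (e i) (e i) ≡ e j) × (f (e i) (e j) (e i) ≡ e j) × (f (e i) (e i) (e j) ≡ e j)

IsMinority : ∀ {X : Set} → (X → X → X → X) → Set
IsMinority {X} f = IsMinorityOn f (λ (x : X) → x)

minority-isMinority : ∀ {n} → IsMinority (minority {n})
minority-isMinority x y = minority-yxx , minority-xyx , minority-xxy
  where
  minority-yxx : minority y x x ≡ y
  minority-yxx with x ≟ x
  ... | yes _ = refl
  ... | no x≢x = contradiction refl x≢x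

  minority-xyx : minority x y x ≡ y
  minority-xyx with y ≟ x
  ... | yes y≡x = sym y≡x
  ... | no _ with x ≟ x
  ...   | yes _ = refl
  ...   | no x≢x = contradiction refl x≢x

  minority-xxy : minority x x y ≡ y
  minority-xxy with x ≟ y
  ... | yes x≡y = x≡y
  ... | no _ with x ≟ y
  ...   | yes x≡y = x≡y
  ...   | no _ = refl

xor3 : Fin 4 → Fin 4 → Fin 4 → Fin 4
xor3 b₁ b₂ b₃ = (b₁ ⊕ b₂) ⊕ b₃

xor3-isMinority : IsMinority xor3
xor3-isMinority 0F 0F = refl , refl , refl
xor3-isMinority 0F 1F = refl , refl , refl
xor3-isMinority 0F 2F = refl , refl , refl
xor3-isMinority 0F 3F = refl , refl , refl
xor3-isMinority 1F 0F = refl , refl , refl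
xor3-isMinority 1F 1F = refl , refl , refl
xor3-isMinority 1F 2F = refl , refl , refl
xor3-isMinority 1F 3F = refl , refl , refl
xor3-isMinority 2F 0F = refl , refl , refl
xor3-isMinority 2F 1F = refl , refl , refl
xor3-isMinority 2F 2F = refl , refl , refl
xor3-isMinority 2F 3F = refl , refl , refl
xor3-isMinority 3F 0F = refl , refl , refl
xor3-isMinority 3F 1F = refl , refl , refl
xor3-isMinority 3F 2F = refl , refl , refl
xor3-isMinority 3F 3F = refl , refl , refl

_⊗_ : ∀ {X Y : Set} → (X → X → X → X) → (Y → Y → Y → Y) → (X × Y → X × Y → X × Y → X × Y)
(f ⊗ g) (x₁ , y₁) (x₂ , y₂) (x₃ , y₃) = f x₁ x₂ x₃ , g y₁ y₂ y₃

⊗-isMinority : ∀ {X Y : Set} {f : X → X → X → X} {g : Y → Y → Y → Y} →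
  IsMinority f → IsMinority g → IsMinority (f ⊗ g)
⊗-isMinority {f = f} {g = g} f-min g-min (x , y) (x′ , y′) =
  cong₂ _,_ (proj₁ fx) (proj₁ gy) ,
  cong₂ _,_ (proj₁ (proj₂ fx)) (proj₁ (proj₂ gy)) ,
  cong₂ _,_ (proj₂ (proj₂ fx)) (proj₂ (proj₂ gy))
  where
  fx : (f x′ x x ≡ x′) × (f x x′ x ≡ x′) × (f x x x′ ≡ x′)
  fx = f-min x x′

  gy : (g y′ y y ≡ y′) × (g y y′ y ≡ y′) × (g y y y′ ≡ y′)
  gy = g-min y y′

t-outside : ∀ {n} (i : Fin n) (x y z : A n) → proj₁ x ≢ i →
  t i x y z ≡ (minority ⊗ xor3) x y z
t-outside i (a₁ , b₁) (a₂ , b₂) (a₃ , b₃) a₁≢i with a₁ ≟ i | a₂ ≟ i | a₃ ≟ i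
... | yes a₁≡i | _     | _     = contradiction a₁≡i a₁≢i
... | no _     | yes _ | yes _ = refl
... | no _     | yes _ | no _  = refl
... | no _     | no _  | yes _ = refl
... | no _     | no _  | no _  = refl

t-isMinorityOn : ∀ {n} {I : Set} (k : Fin n) (e : I → A n) →
  (∀ j → proj₁ (e j) ≢ k) → IsMinorityOn (t k) e
t-isMinorityOn {n} k e avoids i j =
  trans (t-outside k (e j) (e i) (e i) (avoids j)) (proj₁ (coordinatewise (e i) (e j))) ,
  trans (t-outside k (e i) (e j) (e i) (avoids i)) (proj₁ (proj₂ (coordinatewise (e i) (e j)))) ,
  trans (t-outside k (e i) (e i) (e j) (avoids i)) (proj₂ (proj₂ (coordinatewise (e i) (e j))))
  where
  coordinatewise : IsMinority {A n} (minority ⊗ xor3)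
  coordinatewise = ⊗-isMinority {f = minority} {g = xor3} minority-isMinority xor3-isMinority

-- A map Fin m → Fin (suc m) misses some value: were it surjective, choosing
-- preimages would give an injection Fin (suc m) → Fin m.
missedValue : ∀ {m} (f : Fin m → Fin (suc m)) → ∃ λ k → ∀ j → f j ≢ k
missedValue {m} f with all? (λ k → any? (λ j → f j ≟ k))
... | yes surjective = contradiction (injective⇒≤ section-injective) 1+n≰n
  where
  section : Fin (suc m) → Fin m
  section k = proj₁ (surjective k)

  section-injective : Injective _≡_ _≡_ section
  section-injective {k} {k′} eq =
    trans (sym (proj₂ (surjective k))) (trans (cong f eq) (proj₂ (surjective k′)))
... | no ¬surjective with ¬∀⟶∃¬ _ _ (λ k → any? (λ j → f j ≟ k)) ¬surjective
...   | k , unreached = k , λ j fj≡k → unreached (j , fj≡k)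

basicTerm : ∀ {n} → Fin n → Term n 3
basicTerm k = op k (var 0F) (var 1F) (var 2F)

claim5p3 : (n : ℕ) → 2 < n → n % 2 ≡ 1 →
    (e : Fin (n ∸ 1) → A n) → Injective _≡_ _≡_ e →
    Σ (Term n 3) λ s → (i j : Fin (n ∸ 1)) →
      (app3 s (e j) (e i) (e i) ≡ e j) ×
      (app3 s (e i) (e j) (e i) ≡ e j) ×
      (app3 s (e i) (e i) (e j) ≡ e j)
claim5p3 (suc m) _ _ e _ = basicTerm k , t-isMinorityOn k e avoids
  where
  k : Fin (suc m)
  k = proj₁ (missedValue (λ j → proj₁ (e j)))

  avoids : ∀ j → proj₁ (e j) ≢ k
  avoids = proj₂ (missedValue (λ j → proj₁ (e j)))
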